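{- Let $h \geq 2$ and let $f$ be a function such that $f(n)$ is a positive integer for every nonnegative integer $n$. There exists a set $A$ of nonnegative integers (a basis of order $h$) with $r_A(n,h) = f(n)$ for all $n \geq 0$ if and only if for every $N$ there exists a finite set $A_N$ of nonnegative integers with $\max(A_N) \geq N$ and $r_{A_N}(n,h) = f(n)$ for all $n = 0, 1,\ldots,\max(A_N)$.
   Context: For a set $A$ of nonnegative integers, a nonnegative integer $n$ and a positive integer $h$, $r_A(n,h)$ denotes the number of representations $n = a_1 + \cdots + a_h$ with $a_1,\ldots,a_h \in A$ and $a_1 \leq a_2 \leq \cdots \leq a_h$. A set $A$ of nonnegative integers is a basis of order $h$ if $r_A(n,h)\ge 1$ for every nonnegative integer $n$. -}

module Defs where

open import Data.Nat using (ℕ; zero; suc; _+_; _≤_; _≤ᵇ_; _≡ᵇ_)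
open import Data.Bool using (Bool; true; false; _∧_; _∨_)
open import Data.List using (List; []; _∷_; length; filter; map; concatMap; upTo)
open import Data.Bool.ListAction using (any; all)
open import Data.Nat.ListAction using (sum)
open import Relation.Nullary.Decidable using (Dec)
open import Data.Bool using (T?)

SetOfℕ : Set
SetOfℕ = ℕ → Bool

listSet : List ℕ → SetOfℕ
listSet xs n = any (n ≡ᵇ_) xs

tuples : ℕ → ℕ → List (List ℕ)
tuples zero    n = [] ∷ []
tuples (suc h) n = concatMap (λ a → map (a ∷_) (tuples h n)) (upTo (suc n))

sortedᵇ : List ℕ → Bool
sortedᵇ []           = true
sortedᵇ (x ∷ [])     = true
sortedᵇ (x ∷ y ∷ xs) = (x ≤ᵇ y) ∧ sortedᵇ (y ∷ xs)

isRepᵇ : SetOfℕ → ℕ → List ℕ → Bool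
isRepᵇ A n xs = all A xs ∧ sortedᵇ xs ∧ (sum xs ≡ᵇ n)

-- r_A(n,h): number of representations n = a₁ + ... + aₕ, aᵢ ∈ A, a₁ ≤ ... ≤ aₕ
-- (every aᵢ ≤ n, so it suffices to enumerate tuples with entries in {0,...,n})
r : SetOfℕ → ℕ → ℕ → ℕ
r A n h = length (filter (λ xs → T? (isRepᵇ A n xs)) (tuples h n))

{-# OPTIONS --safe #-}
module Submission where

-- The representation function determines the set: if A and B contain 0 and agree below k,
-- but k ∈ B ∖ A, then every representation of k by A is one by B, while 0 + ⋯ + 0 + k is
-- one by B only, so r_A(k,h) < r_B(k,h).  Hence the finite sets A_N, which contain 0 since
-- f(0) ≥ 1, agree with each other on every initial segment where they both represent f, and
-- the diagonal set {x | x ∈ A_x} represents f everywhere.  Conversely, r_A(n,h) depends only on A ∩ [0,n], and A is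
-- unbounded (a representation of hN has a summand ≥ N), so truncating A at a large element
-- gives A_N.

open import Defs
open import Data.Nat using (ℕ; _≤_)
open import Data.List using (List)
open import Data.List.Membership.Propositional using (_∈_)
open import Data.Product using (Σ; _×_)
open import Relation.Binary.PropositionalEquality using (_≡_)
open import Function.Bundles using (_⇔_)

open import Data.Bool using (true; false; T; T?)
open import Data.Bool.Properties using (T-∧)
open import Data.Bool.ListAction using (all)
open import Data.Empty using (⊥-elim)
open import Data.List using ([]; _∷_; length; filter; map; upTo)
open import Data.List.Properties using (filter-≐)
open import Data.List.Membership.Propositional using (find)
open import Data.List.Membership.Propositional.Properties
  using (∈-filter⁺; ∈-filter⁻; ∈-map⁺; ∈-map⁻; ∈-concatMap⁺; ∈-concatMap⁻;
         ∈-upTo⁺; ∈-upTo⁻)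
open import Data.List.Relation.Unary.All as All using (All; _∷_)
open import Data.List.Relation.Unary.All.Properties using (all⁺; all⁻; ¬Any⇒All¬)
open import Data.List.Relation.Unary.Any as Any using (Any; here; there; any?)
open import Data.List.Relation.Unary.Any.Properties using (any⁺; any⁻)
open import Data.List.Relation.Binary.Sublist.Propositional using (⊆-refl)
  renaming (_⊆_ to _⊑_)
open import Data.List.Relation.Binary.Sublist.Propositional.Properties
  using (filter⁺; length-mono-≤; to-≋)
open import Data.List.Relation.Binary.Equality.Propositional using (≋⇒≡)
open import Data.Nat using (zero; suc; _*_; _<_; z≤n; s≤s; z<s; _≤?_; _≡ᵇ_)
open import Data.Nat.Properties
open import Data.Nat.ListAction using (sum)
open import Data.Product using (_,_; proj₁; proj₂; ∃-syntax)
open import Data.Sum using (inj₁; inj₂)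
open import Data.Unit using (tt)
open import Function using (_∘_)
open import Function.Bundles using (mk⇔; Equivalence)
open import Relation.Binary.PropositionalEquality using (refl; sym; trans; cong; subst)
open import Relation.Nullary using (¬_; yes; no; contradiction)
open import Relation.Nullary.Decidable using (decidable-stable)
open import Relation.Unary using (Decidable; _⊆_)

open Equivalence using (to; from)

T-injective : ∀ {a b} → (T a → T b) → (T b → T a) → a ≡ b
T-injective {false} {false} _   _   = refl
T-injective {false} {true}  _   b⇒a = ⊥-elim (b⇒a tt)
T-injective {true}  {false} a⇒b _   = ⊥-elim (a⇒b tt)
T-injective {true}  {true}  _   _   = refl

module _ {X : Set} {P : X → Set} (P? : Decidable P) where

  0<length-filter⇒∃ : ∀ {xs} → 0 < length (filter P? xs) → ∃[ x ] x ∈ xs × P x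
  0<length-filter⇒∃ {xs} pos with filter P? xs in eq
  ... | x ∷ _ = x , ∈-filter⁻ P? (subst (x ∈_) (sym eq) (here refl))

  length-filter-< : ∀ {Q : X → Set} (Q? : Decidable Q) → P ⊆ Q →
                    ∀ {w xs} → w ∈ xs → ¬ P w → Q w →
                    length (filter P? xs) < length (filter Q? xs)
  length-filter-< Q? P⊆Q {w} {xs} w∈xs ¬Pw Qw =
    ≤∧≢⇒< (length-mono-≤ sublist) (¬Pw ∘ P-w)
    where
    sublist : filter P? xs ⊑ filter Q? xs
    sublist = filter⁺ P? Q? {as = xs} (λ { refl → P⊆Q }) ⊆-refl
    P-w : length (filter P? xs) ≡ length (filter Q? xs) → P w
    P-w same-length = proj₂ (∈-filter⁻ P? {xs = xs} w∈filterP)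
      where
      w∈filterP : w ∈ filter P? xs
      w∈filterP = subst (w ∈_) (sym (≋⇒≡ (to-≋ same-length sublist))) (∈-filter⁺ Q? w∈xs Qw)

∈⇒≤-sum : ∀ {x xs} → x ∈ xs → x ≤ sum xs
∈⇒≤-sum {xs = y ∷ ys} (here refl) = m≤m+n y (sum ys)
∈⇒≤-sum {xs = y ∷ ys} (there x∈) = ≤-trans (∈⇒≤-sum x∈) (m≤n+m (sum ys) y)

sum≤length* : ∀ {N xs} → All (_≤ N) xs → sum xs ≤ length xs * N
sum≤length* All.[]        = z≤n
sum≤length* (x≤N ∷ xs≤N) = +-mono-≤ x≤N (sum≤length* xs≤N)

length*≤sum⇒∃≥ : ∀ {N} xs → 0 < length xs → length xs * N ≤ sum xs →
                 Any (N ≤_) xs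
length*≤sum⇒∃≥ {N} (x ∷ xs) _ l*N≤sum with any? (N ≤?_) (x ∷ xs)
... | yes some = some
... | no  none with x<N ∷ xs<N ← All.map ≰⇒> (¬Any⇒All¬ (x ∷ xs) none) =
  contradiction l*N≤sum (<⇒≱ (+-mono-<-≤ x<N (sum≤length* (All.map <⇒≤ xs<N))))

∷-∈-tuples : ∀ {h n x xs} → x ≤ n → xs ∈ tuples h n → x ∷ xs ∈ tuples (suc h) n
∷-∈-tuples {h} {n} {x} x≤n xs∈ =
  ∈-concatMap⁺ (λ a → map (a ∷_) (tuples h n))
    (Any.map (λ { refl → ∈-map⁺ (x ∷_) xs∈ }) (∈-upTo⁺ (s≤s x≤n)))

∈-tuples⇒length : ∀ h {n xs} → xs ∈ tuples h n → length xs ≡ h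
∈-tuples⇒length zero    (here refl) = refl
∈-tuples⇒length (suc h) {n} xs∈
  with a , xs∈map ← Any.satisfied (∈-concatMap⁻ (λ a → map (a ∷_) (tuples h n))
                                                 {xs = upTo (suc n)} xs∈)
  with _ , ys∈ , refl ← ∈-map⁻ (a ∷_) xs∈map
  = cong suc (∈-tuples⇒length h ys∈)

record IsRep (A : SetOfℕ) (n : ℕ) (xs : List ℕ) : Set where
  constructor isRep
  field
    all-∈  : All (T ∘ A) xs
    sorted : T (sortedᵇ xs)
    sum≡   : sum xs ≡ n

T-isRepᵇ : ∀ {A n xs} → T (isRepᵇ A n xs) ⇔ IsRep A n xs
T-isRepᵇ {A} {n} {xs} = mk⇔
  (λ t → let inA , rest = to (T-∧ {all A xs}) t
             sorted , sum≡ = to (T-∧ {sortedᵇ xs}) rest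
         in isRep (all⁺ A xs inA) sorted (≡ᵇ⇒≡ (sum xs) n sum≡))
  (λ (isRep inA sorted sum≡) →
     from T-∧ (all⁻ A inA , from T-∧ (sorted , ≡⇒≡ᵇ (sum xs) n sum≡)))

IsRep⇒≤ : ∀ {A n xs x} → IsRep A n xs → x ∈ xs → x ≤ n
IsRep⇒≤ rep x∈ = subst (_ ≤_) (IsRep.sum≡ rep) (∈⇒≤-sum x∈)

IsRep-mono : ∀ {A B n xs} → (∀ {x} → x ≤ n → T (A x) → T (B x)) →
             IsRep A n xs → IsRep B n xs
IsRep-mono A⇒B rep@(isRep inA sorted sum≡) =
  isRep (All.tabulate (λ x∈ → A⇒B (IsRep⇒≤ rep x∈) (All.lookup inA x∈))) sorted sum≡

T-isRepᵇ-mono : ∀ {A B n} → (∀ {x} → x ≤ n → T (A x) → T (B x)) →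
                T ∘ isRepᵇ A n ⊆ T ∘ isRepᵇ B n
T-isRepᵇ-mono {A} {B} {n} A⇒B {xs} =
  from (T-isRepᵇ {B} {n} {xs}) ∘ IsRep-mono A⇒B ∘ to (T-isRepᵇ {A} {n} {xs})

IsRep-0⇒0∈ : ∀ {A x xs} → IsRep A 0 (x ∷ xs) → T (A 0)
IsRep-0⇒0∈ rep with refl ← n≤0⇒n≡0 (IsRep⇒≤ rep (here refl)) =
  All.head (IsRep.all-∈ rep)

IsRep⇒∃≥ : ∀ {A h N xs} → length xs ≡ suc h → IsRep A (suc h * N) xs →
           ∃[ m ] N ≤ m × T (A m)
IsRep⇒∃≥ {N = N} {xs} length≡ rep =
  let m , m∈ , N≤m = find (length*≤sum⇒∃≥ xs (subst (0 <_) (sym length≡) z<s) l*N≤sum)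
  in m , N≤m , All.lookup (IsRep.all-∈ rep) m∈
  where
  l*N≤sum : length xs * N ≤ sum xs
  l*N≤sum = ≤-reflexive (trans (cong (_* N) length≡) (sym (IsRep.sum≡ rep)))

AgreeBelow : ℕ → SetOfℕ → SetOfℕ → Set
AgreeBelow k A B = ∀ {x} → x < k → A x ≡ B x

AgreeBelow-suc : ∀ {k A B} → AgreeBelow k A B → A k ≡ B k → AgreeBelow (suc k) A B
AgreeBelow-suc below at x<1+k with m<1+n⇒m<n∨m≡n x<1+k
... | inj₁ x<k  = below x<k
... | inj₂ refl = at

r-cong : ∀ {A B n h} → AgreeBelow (suc n) A B → r A n h ≡ r B n h
r-cong {A} {B} {n} {h} A≐B =
  cong length (filter-≐ (T? ∘ isRepᵇ A n) (T? ∘ isRepᵇ B n)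
                        ((λ {xs} → T-isRepᵇ-mono {A} {B} A⇒B {xs}) ,
                         (λ {xs} → T-isRepᵇ-mono {B} {A} B⇒A {xs}))
                        (tuples h n))
  where
  A⇒B : ∀ {x} → x ≤ n → T (A x) → T (B x)
  A⇒B x≤n = subst T (A≐B (s≤s x≤n))
  B⇒A : ∀ {x} → x ≤ n → T (B x) → T (A x)
  B⇒A x≤n = subst T (sym (A≐B (s≤s x≤n)))

zeros-then : ℕ → ℕ → List ℕ
zeros-then zero    k = k ∷ []
zeros-then (suc h) k = 0 ∷ zeros-then h k

module _ {k : ℕ} where

  ∈-zeros-then : ∀ h → k ∈ zeros-then h k
  ∈-zeros-then zero    = here refl
  ∈-zeros-then (suc h) = there (∈-zeros-then h)

  zeros-then-∈-tuples : ∀ h → zeros-then h k ∈ tuples (suc h) k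
  zeros-then-∈-tuples zero    = ∷-∈-tuples {h = 0} {n = k} ≤-refl (here refl)
  zeros-then-∈-tuples (suc h) = ∷-∈-tuples {h = suc h} {n = k} z≤n (zeros-then-∈-tuples h)

  IsRep-zeros-then : ∀ {A} h → T (A 0) → T (A k) → IsRep A k (zeros-then h k)
  IsRep-zeros-then {A} h A0 Ak = isRep (all-∈ h) (sorted h) (sum≡ h)
    where
    all-∈ : ∀ h → All (T ∘ A) (zeros-then h k)
    all-∈ zero    = Ak ∷ All.[]
    all-∈ (suc h) = A0 ∷ all-∈ h
    sorted : ∀ h → T (sortedᵇ (zeros-then h k))
    sorted zero          = tt
    sorted (suc zero)    = tt
    sorted (suc (suc h)) = sorted (suc h)
    sum≡ : ∀ h → sum (zeros-then h k) ≡ k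
    sum≡ zero    = +-identityʳ k
    sum≡ (suc h) = sum≡ h

r-< : ∀ {A B k h} → AgreeBelow k A B → T (B 0) → T (B k) → ¬ T (A k) →
      r A k (suc h) < r B k (suc h)
r-< {A} {B} {k} {h} A≐B B0 Bk ¬Ak =
  length-filter-< (T? ∘ isRepᵇ A k) (T? ∘ isRepᵇ B k)
    (λ {xs} → T-isRepᵇ-mono {A} {B} A⇒B {xs})
    (zeros-then-∈-tuples h)
    (λ t → ¬Ak (All.lookup (IsRep.all-∈ (to T-isRepᵇ t)) (∈-zeros-then h)))
    (from T-isRepᵇ (IsRep-zeros-then h B0 Bk))
  where
  A⇒B : ∀ {x} → x ≤ k → T (A x) → T (B x)
  A⇒B x≤k Ax with m≤n⇒m<n∨m≡n x≤k
  ... | inj₁ x<k  = subst T (A≐B x<k) Ax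
  ... | inj₂ refl = contradiction Ax ¬Ak

r-≡⇒≡ : ∀ {A B k h} → AgreeBelow k A B → T (A 0) → T (B 0) →
        r A k (suc h) ≡ r B k (suc h) → A k ≡ B k
r-≡⇒≡ {A} {B} {k} {h} A≐B A0 B0 rA≡rB = T-injective
  (λ Ak → decidable-stable (T? (B k)) λ ¬Bk →
            <⇒≢ (r-< {h = h} (λ x<k → sym (A≐B x<k)) A0 Ak ¬Bk) (sym rA≡rB))
  (λ Bk → decidable-stable (T? (A k)) λ ¬Ak →
            <⇒≢ (r-< {h = h} A≐B B0 Bk ¬Ak) rA≡rB)

r-≡⇒AgreeBelow : ∀ {A B M h} → T (A 0) → T (B 0) →
                 (∀ {k} → k < M → r A k (suc h) ≡ r B k (suc h)) → AgreeBelow M A B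
r-≡⇒AgreeBelow {M = zero} _ _ _ ()
r-≡⇒AgreeBelow {A} {B} {suc M} {h} A0 B0 rA≡rB =
  AgreeBelow-suc below (r-≡⇒≡ {h = h} below A0 B0 (rA≡rB (n<1+n M)))
  where
  below : AgreeBelow M A B
  below = r-≡⇒AgreeBelow {h = h} A0 B0 (rA≡rB ∘ m<n⇒m<1+n)

r-pos⇒0∈ : ∀ {A h} → 0 < r A 0 (suc h) → T (A 0)
r-pos⇒0∈ {A} {h} pos with 0<length-filter⇒∃ (T? ∘ isRepᵇ A 0) pos
... | x ∷ xs , _   , t = IsRep-0⇒0∈ (to (T-isRepᵇ {A} {0} {x ∷ xs}) t)
... | []     , []∈ , _ with () ← ∈-tuples⇒length (suc h) []∈

r-pos⇒unbounded : ∀ {A h} → (∀ n → 0 < r A n (suc h)) →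
                  ∀ N → ∃[ m ] N ≤ m × T (A m)
r-pos⇒unbounded {A} {h} r-pos N
  with xs , xs∈ , t ← 0<length-filter⇒∃ (T? ∘ isRepᵇ A (suc h * N)) (r-pos (suc h * N))
  = IsRep⇒∃≥ (∈-tuples⇒length (suc h) xs∈) (to (T-isRepᵇ {A} {suc h * N} {xs}) t)

T-listSet : ∀ {xs y} → T (listSet xs y) ⇔ y ∈ xs
T-listSet {xs} {y} = mk⇔
  (Any.map (≡ᵇ⇒≡ y _) ∘ any⁻ (y ≡ᵇ_) xs)
  (any⁺ (y ≡ᵇ_) ∘ Any.map (λ { refl → ≡⇒≡ᵇ y y refl }))

truncate : SetOfℕ → ℕ → List ℕ
truncate A m = filter (T? ∘ A) (upTo (suc m))

∈-truncate : ∀ {A m x} → x ∈ truncate A m ⇔ (x ≤ m × T (A x))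
∈-truncate {A} {m} = mk⇔
  (λ x∈ → let x∈upTo , Ax = ∈-filter⁻ (T? ∘ A) {xs = upTo (suc m)} x∈
          in ≤-pred (∈-upTo⁻ x∈upTo) , Ax)
  (λ (x≤m , Ax) → ∈-filter⁺ (T? ∘ A) (∈-upTo⁺ (s≤s x≤m)) Ax)

listSet-truncate : ∀ {A m x} → x ≤ m → listSet (truncate A m) x ≡ A x
listSet-truncate {A} {m} x≤m = T-injective
  (proj₂ ∘ to (∈-truncate {A} {m}) ∘ to (T-listSet {truncate A m}))
  (λ Ax → from (T-listSet {truncate A m}) (from (∈-truncate {A}) (x≤m , Ax)))

Represents : ℕ → (ℕ → ℕ) → SetOfℕ → Set
Represents h f A = ∀ n → r A n h ≡ f n

RepresentsUpTo : ℕ → (ℕ → ℕ) → ℕ → SetOfℕ → Set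
RepresentsUpTo h f N A = ∀ {n} → n ≤ N → r A n h ≡ f n

Approximation : ℕ → (ℕ → ℕ) → ℕ → Set
Approximation h f N = Σ (List ℕ) (λ AN → Σ ℕ (λ m →
  m ∈ AN × (∀ a → a ∈ AN → a ≤ m) × N ≤ m
  × (∀ n → n ≤ m → r (listSet AN) n h ≡ f n)))

truncate-approximation : ∀ {h f A m N} → Represents h f A → T (A m) → N ≤ m →
                         Approximation h f N
truncate-approximation {h} {A = A} {m} rep Am N≤m =
  truncate A m , m , from (∈-truncate {A}) (≤-refl , Am) ,
  (λ _ → proj₁ ∘ to (∈-truncate {A})) , N≤m ,
  λ n n≤m → trans (r-cong {h = h} (agree n≤m)) (rep n)
  where
  agree : ∀ {n} → n ≤ m → AgreeBelow (suc n) (listSet (truncate A m)) A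
  agree n≤m x<1+n = listSet-truncate {A} (≤-trans (≤-pred x<1+n) n≤m)

approximation⇒RepresentsUpTo : ∀ {h f N} → Approximation h f N →
                               Σ SetOfℕ (RepresentsUpTo h f N)
approximation⇒RepresentsUpTo (AN , _ , _ , _ , N≤m , rep) =
  listSet AN , λ n≤N → rep _ (≤-trans n≤N N≤m)

representable⇒approximations : ∀ {h f} → (∀ n → 0 < f n) →
                               Σ SetOfℕ (Represents (suc h) f) →
                               ∀ N → Approximation (suc h) f N
representable⇒approximations {h} f>0 (A , rep) N =
  let m , N≤m , Am = r-pos⇒unbounded {A} {h} (λ n → subst (0 <_) (sym (rep n)) (f>0 n)) N
  in truncate-approximation {suc h} {A = A} rep Am N≤m

locally-representable⇒representable : ∀ {h f} → 0 < f 0 →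
  (∀ N → Σ SetOfℕ (RepresentsUpTo (suc h) f N)) → Σ SetOfℕ (Represents (suc h) f)
locally-representable⇒representable {h} {f} f0>0 local =
  diagonal , λ n → trans (r-cong {h = suc h} (diagonal-agrees n)) (B-rep n ≤-refl)
  where
  B : ℕ → SetOfℕ
  B = proj₁ ∘ local
  B-rep : ∀ N → RepresentsUpTo (suc h) f N (B N)
  B-rep = proj₂ ∘ local
  0∈B : ∀ N → T (B N 0)
  0∈B N = r-pos⇒0∈ {h = h} (subst (0 <_) (sym (B-rep N z≤n)) f0>0)
  B-agree : ∀ {k n} → k ≤ n → AgreeBelow (suc k) (B k) (B n)
  B-agree {k} {n} k≤n = r-≡⇒AgreeBelow {h = h} (0∈B k) (0∈B n) λ j<1+k →
    let j≤k = ≤-pred j<1+k in trans (B-rep k j≤k) (sym (B-rep n (≤-trans j≤k k≤n)))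
  diagonal : SetOfℕ
  diagonal x = B x x
  diagonal-agrees : ∀ n → AgreeBelow (suc n) diagonal (B n)
  diagonal-agrees n x<1+n = B-agree (≤-pred x<1+n) (n<1+n _)

theorem5 : (h : ℕ) → 2 ≤ h → (f : ℕ → ℕ) → (∀ n → 1 ≤ f n) →
    (Σ SetOfℕ (λ A → ∀ n → r A n h ≡ f n))
    ⇔ (∀ N → Σ (List ℕ) (λ AN → Σ ℕ (λ m →
          m ∈ AN × (∀ a → a ∈ AN → a ≤ m) × N ≤ m
          × (∀ n → n ≤ m → r (listSet AN) n h ≡ f n))))
theorem5 (suc h) (s≤s _) f f>0 = mk⇔
  (representable⇒approximations {h} f>0)
  (λ approx → locally-representable⇒representable {h} (f>0 0)
                (approximation⇒RepresentsUpTo {suc h} {f} ∘ approx))
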